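{- Let $N\ge1$ and $T=\begin{pmatrix}1&1\\0&1\end{pmatrix}$. Fix a right transversal of $\Gamma_1(N)$ in $\mathrm{SL}_2(\mathbb{Z})$, with right coset representative function $g\mapsto\overline{g}$. Let $a$ be an integer, written as $a=qN+r$ with $0\le r<N$, and let $M\in\mathrm{SL}_2(\mathbb{Z})$. Then $$U(\overline{M},T^a)=U(\overline{M},T^N)^{q}\,U(\overline{M},T^r).$$
   Context: A right transversal of a subgroup $H$ in a group $G$ is a subset of $G$ that contains the identity and contains exactly one element of each right coset $Hg$. For $g\in G$, $\overline{g}$ denotes the unique element of the transversal with $Hg=H\overline{g}$. For $x,y\in G$, define $U(x,y)=xy\,(\overline{xy})^{ -1}$. -}

module Defs where

open import Data.Nat using (ℕ; zero; suc)
open import Data.Integer using (ℤ; +_; -[1+_]; _+_; _*_; _-_; -_; 1ℤ; 0ℤ)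
open import Data.Integer.Divisibility using (_∣_)
open import Data.Product using (Σ; _×_; _,_)
open import Relation.Binary.PropositionalEquality using (_≡_; refl; trans; cong₂)
open import Data.Integer.Solver using (module +-*-Solver)
open +-*-Solver

record SL2 : Set where
  constructor mkSL2
  field
    a b c d : ℤ
    det≡1 : a * d - b * c ≡ 1ℤ
open SL2 public

private
  det-mul : ∀ a b c d a' b' c' d' →
    (a * a' + b * c') * (c * b' + d * d') - (a * b' + b * d') * (c * a' + d * c')
      ≡ (a * d - b * c) * (a' * d' - b' * c')
  det-mul = solve 8 (λ a b c d a' b' c' d' →
    (a :* a' :+ b :* c') :* (c :* b' :+ d :* d') :- (a :* b' :+ b :* d') :* (c :* a' :+ d :* c')
      := (a :* d :- b :* c) :* (a' :* d' :- b' :* c')) refl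

  det-inv : ∀ a b c d → d * a - (- b) * (- c) ≡ a * d - b * c
  det-inv = solve 4 (λ a b c d → d :* a :- (:- b) :* (:- c) := a :* d :- b :* c) refl

_·_ : SL2 → SL2 → SL2
mkSL2 a b c d p · mkSL2 a' b' c' d' p' =
  mkSL2 (a * a' + b * c') (a * b' + b * d') (c * a' + d * c') (c * b' + d * d')
        (trans (det-mul a b c d a' b' c' d') (cong₂ _*_ p p'))
infixl 7 _·_

I : SL2
I = mkSL2 1ℤ 0ℤ 0ℤ 1ℤ refl

_⁻¹ : SL2 → SL2
mkSL2 a b c d p ⁻¹ = mkSL2 d (- b) (- c) a (trans (det-inv a b c d) p)
infix 8 _⁻¹

T : SL2
T = mkSL2 1ℤ 1ℤ 0ℤ 1ℤ refl

_^ℕ_ : SL2 → ℕ → SL2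
g ^ℕ zero = I
g ^ℕ suc n = g · (g ^ℕ n)

_^_ : SL2 → ℤ → SL2
g ^ (+ n) = g ^ℕ n
g ^ -[1+ n ] = (g ⁻¹) ^ℕ (suc n)

Γ₁ : ℕ → SL2 → Set
Γ₁ N g = ((+ N) ∣ (a g - 1ℤ)) × ((+ N) ∣ c g) × ((+ N) ∣ (d g - 1ℤ))

SameRightCoset : ℕ → SL2 → SL2 → Set
SameRightCoset N g h = Γ₁ N (g · h ⁻¹)

-- A right transversal of Γ₁(N) in SL₂(ℤ): a subset S containing the
-- identity and exactly one element of each right coset.  `rep g` is the
-- element of S in the coset of g (the map g ↦ ḡ).
record RightTransversal (N : ℕ) : Set₁ where
  field
    S         : SL2 → Set
    S-id      : S I
    rep       : SL2 → SL2
    rep-∈     : ∀ g → S (rep g)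
    rep-coset : ∀ g → SameRightCoset N g (rep g)
    unique    : ∀ x y → S x → S y → SameRightCoset N x y → x ≡ y

U : {N : ℕ} → RightTransversal N → SL2 → SL2 → SL2
U τ x y = x · y · (RightTransversal.rep τ (x · y)) ⁻¹

{-# OPTIONS --safe #-}
module Submission where

-- Write g ↦ g ḡ⁻¹ for the Γ₁(N)-part of g, so that U(x, y) is the Γ₁(N)-part of xy,
-- and γ g has Γ₁(N)-part γ (g ḡ⁻¹) when γ ∈ Γ₁(N).  For N ∣ k the conjugate x Tᵏ x⁻¹
-- lies in Γ₁(N) (its entries are 1 - kac, ka², -kc², 1 + kac), and
-- x Tᵏ⁺ᵐ = (x Tᵏ x⁻¹)(x Tᵐ), so U(x, Tᵏ⁺ᵐ) = (x Tᵏ x⁻¹) U(x, Tᵐ).  For x in the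
-- transversal the Γ₁(N)-part of x is 1, whence U(x, T^N) = x T^N x⁻¹; its q-th power
-- is x T^{qN} x⁻¹ since k ↦ x Tᵏ x⁻¹ is a homomorphism on ℤ.  Take k = qN, m = r.

open import Defs
open import Data.Nat using (ℕ; _≥_; zero; suc)
open import Data.Integer using (ℤ; +_; -[1+_]; _+_; _*_; _-_; -_; 1ℤ; 0ℤ; _≤_; _<_)
open import Data.Integer.Properties
  using (_≟_; *-zeroʳ; *-identityʳ; +-inverseˡ; suc-*; neg-distribˡ-*; neg-distribʳ-*)
open import Data.Integer.Divisibility.Signed
  using (_∣_; ∣ᵤ⇒∣; ∣⇒∣ᵤ; ∣-refl; ∣m∣n⇒∣m+n; ∣m⇒∣-m; ∣n⇒∣m*n; ∣m⇒∣m*n)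
open import Data.Integer.Tactic.RingSolver using (solve-∀)
open import Data.Product using (_,_)
open import Level using (0ℓ)
open import Algebra.Bundles using (Group)
open import Algebra.Structures using (IsGroup)
open import Algebra.Properties.Group using (identityˡ-unique; inverseˡ-unique; inverseʳ-unique)
open import Axiom.UniquenessOfIdentityProofs using (module Decidable⇒UIP)
open import Relation.Binary.PropositionalEquality
open ≡-Reasoning

SL2-≡ : ∀ {g h} → a g ≡ a h → b g ≡ b h → c g ≡ c h → d g ≡ d h → g ≡ h
SL2-≡ {mkSL2 a b c d p} {mkSL2 _ _ _ _ q} refl refl refl refl =
  cong (mkSL2 a b c d) (Decidable⇒UIP.≡-irrelevant _≟_ p q)

·-assoc : ∀ g h k → (g · h) · k ≡ g · (h · k)
·-assoc (mkSL2 a₁ b₁ c₁ d₁ _) (mkSL2 a₂ b₂ c₂ d₂ _) (mkSL2 a₃ b₃ c₃ d₃ _) =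
  SL2-≡ (row a₁ b₁ a₂ b₂ c₂ d₂ a₃ c₃) (row a₁ b₁ a₂ b₂ c₂ d₂ b₃ d₃)
        (row c₁ d₁ a₂ b₂ c₂ d₂ a₃ c₃) (row c₁ d₁ a₂ b₂ c₂ d₂ b₃ d₃)
  where
  row : ∀ x y a b c d z w →
    (x * a + y * c) * z + (x * b + y * d) * w ≡ x * (a * z + b * w) + y * (c * z + d * w)
  row = solve-∀

·-identityˡ : ∀ g → I · g ≡ g
·-identityˡ (mkSL2 a b c d _) = SL2-≡ (first a c) (first b d) (second a c) (second b d)
  where
  first : ∀ x y → 1ℤ * x + 0ℤ * y ≡ x
  first = solve-∀
  second : ∀ x y → 0ℤ * x + 1ℤ * y ≡ y
  second = solve-∀

·-identityʳ : ∀ g → g · I ≡ g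
·-identityʳ (mkSL2 a b c d _) = SL2-≡ (first a b) (second a b) (first c d) (second c d)
  where
  first : ∀ x y → x * 1ℤ + y * 0ℤ ≡ x
  first = solve-∀
  second : ∀ x y → x * 0ℤ + y * 1ℤ ≡ y
  second = solve-∀

⁻¹-inverseʳ : ∀ g → g · g ⁻¹ ≡ I
⁻¹-inverseʳ (mkSL2 a b c d det≡1) =
  SL2-≡ (trans (det₁ a b c d) det≡1) (cancel₁ a b) (cancel₂ c d) (trans (det₂ a b c d) det≡1)
  where
  det₁ : ∀ a b c d → a * d + b * - c ≡ a * d - b * c
  det₁ = solve-∀
  det₂ : ∀ a b c d → c * - b + d * a ≡ a * d - b * c
  det₂ = solve-∀
  cancel₁ : ∀ x y → x * - y + y * x ≡ 0ℤ
  cancel₁ = solve-∀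
  cancel₂ : ∀ x y → x * y + y * - x ≡ 0ℤ
  cancel₂ = solve-∀

⁻¹-involutive : ∀ g → g ⁻¹ ⁻¹ ≡ g
⁻¹-involutive (mkSL2 _ b c _ _) = SL2-≡ refl (neg-involutive b) (neg-involutive c) refl
  where
  neg-involutive : ∀ x → - - x ≡ x
  neg-involutive = solve-∀

⁻¹-inverseˡ : ∀ g → g ⁻¹ · g ≡ I
⁻¹-inverseˡ g = trans (cong (g ⁻¹ ·_) {g} {g ⁻¹ ⁻¹} (sym (⁻¹-involutive g))) (⁻¹-inverseʳ (g ⁻¹))

SL2-isGroup : IsGroup _≡_ _·_ I _⁻¹
SL2-isGroup = record
  { isMonoid = record
    { isSemigroup = record
      { isMagma = record { isEquivalence = isEquivalence ; ∙-cong = cong₂ _·_ }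
      ; assoc = ·-assoc
      }
    ; identity = ·-identityˡ , ·-identityʳ
    }
  ; inverse = ⁻¹-inverseˡ , ⁻¹-inverseʳ
  ; ⁻¹-cong = cong _⁻¹
  }

SL2-group : Group 0ℓ 0ℓ
SL2-group = record
  { Carrier = SL2 ; _≈_ = _≡_ ; _∙_ = _·_ ; ε = I ; _⁻¹ = _⁻¹ ; isGroup = SL2-isGroup }

-- SL2 is an η-record and _·_ matches on mkSL2, so products unfold even on variables,
-- and unifying a metavariable against a product normalises its integer entries, which
-- is very slow.  SL2-valued implicit arguments are therefore supplied explicitly.
x·y·y⁻¹≡x : ∀ x y → x · y · y ⁻¹ ≡ x
x·y·y⁻¹≡x x y = begin
  x · y · y ⁻¹     ≡⟨ ·-assoc x y (y ⁻¹) ⟩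
  x · (y · y ⁻¹)   ≡⟨ cong (x ·_) {y · y ⁻¹} {I} (⁻¹-inverseʳ y) ⟩
  x · I            ≡⟨ ·-identityʳ x ⟩
  x                ∎

x·y⁻¹·y≡x : ∀ x y → x · y ⁻¹ · y ≡ x
x·y⁻¹·y≡x x y = begin
  x · y ⁻¹ · y     ≡⟨ ·-assoc x (y ⁻¹) y ⟩
  x · (y ⁻¹ · y)   ≡⟨ cong (x ·_) {y ⁻¹ · y} {I} (⁻¹-inverseˡ y) ⟩
  x · I            ≡⟨ ·-identityʳ x ⟩
  x                ∎

x·y⁻¹·[y·z]≡x·z : ∀ x y z → x · y ⁻¹ · (y · z) ≡ x · z
x·y⁻¹·[y·z]≡x·z x y z = begin
  x · y ⁻¹ · (y · z)     ≡⟨ ·-assoc x (y ⁻¹) (y · z) ⟩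
  x · (y ⁻¹ · (y · z))   ≡⟨ cong (x ·_) {y ⁻¹ · (y · z)} {y ⁻¹ · y · z} (sym (·-assoc (y ⁻¹) y z)) ⟩
  x · (y ⁻¹ · y · z)     ≡⟨ cong (λ u → x · (u · z)) {y ⁻¹ · y} {I} (⁻¹-inverseˡ y) ⟩
  x · (I · z)            ≡⟨ cong (x ·_) {I · z} {z} (·-identityˡ z) ⟩
  x · z                  ∎

module _ (φ : ℤ → SL2) (φ-homo : ∀ k m → φ (k + m) ≡ φ k · φ m) where

  private
    φ-identity : φ 0ℤ ≡ I
    φ-identity = identityˡ-unique SL2-group (φ 0ℤ) (φ 0ℤ) (sym (φ-homo 0ℤ 0ℤ))

    φ-inverse : ∀ k → φ (- k) ≡ φ k ⁻¹
    φ-inverse k = inverseˡ-unique SL2-group (φ (- k)) (φ k) (begin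
      φ (- k) · φ k   ≡⟨ sym (φ-homo (- k) k) ⟩
      φ (- k + k)     ≡⟨ cong φ (+-inverseˡ k) ⟩
      φ 0ℤ            ≡⟨ φ-identity ⟩
      I               ∎)

  ^ℕ-homo : ∀ k n → φ k ^ℕ n ≡ φ (+ n * k)
  ^ℕ-homo k zero    = sym φ-identity
  ^ℕ-homo k (suc n) = begin
    φ k · φ k ^ℕ n       ≡⟨ cong (φ k ·_) {φ k ^ℕ n} {φ (+ n * k)} (^ℕ-homo k n) ⟩
    φ k · φ (+ n * k)    ≡⟨ sym (φ-homo k (+ n * k)) ⟩
    φ (k + + n * k)      ≡⟨ cong φ (sym (suc-* (+ n) k)) ⟩
    φ (+ suc n * k)      ∎

  ^-homo : ∀ k z → φ k ^ z ≡ φ (z * k)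
  ^-homo k (+ n)     = ^ℕ-homo k n
  ^-homo k -[1+ n ] = begin
    (φ k ⁻¹) ^ℕ suc n        ≡⟨ cong (_^ℕ suc n) {φ k ⁻¹} {φ (- k)} (sym (φ-inverse k)) ⟩
    φ (- k) ^ℕ suc n         ≡⟨ ^ℕ-homo (- k) (suc n) ⟩
    φ (+ suc n * - k)        ≡⟨ cong φ (sym (neg-distribʳ-* (+ suc n) k)) ⟩
    φ (- (+ suc n * k))      ≡⟨ cong φ (neg-distribˡ-* (+ suc n) k) ⟩
    φ (-[1+ n ] * k)         ∎

T[_] : ℤ → SL2
T[ k ] = mkSL2 1ℤ k 0ℤ 1ℤ (cong (λ e → 1ℤ - e) (*-zeroʳ k))

T[]-homo : ∀ k m → T[ k + m ] ≡ T[ k ] · T[ m ]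
T[]-homo k m = SL2-≡ (entry-a k) (entry-b k m) refl (entry-d m)
  where
  entry-a : ∀ k → 1ℤ ≡ 1ℤ * 1ℤ + k * 0ℤ
  entry-a = solve-∀
  entry-b : ∀ k m → k + m ≡ 1ℤ * m + k * 1ℤ
  entry-b = solve-∀
  entry-d : ∀ m → 1ℤ ≡ 0ℤ * m + 1ℤ * 1ℤ
  entry-d = solve-∀

T^≡T[] : ∀ z → T ^ z ≡ T[ z ]
T^≡T[] z = begin
  T ^ z           ≡⟨ cong (_^ z) {T} {T[ 1ℤ ]} (SL2-≡ refl refl refl refl) ⟩
  T[ 1ℤ ] ^ z     ≡⟨ ^-homo T[_] T[]-homo 1ℤ z ⟩
  T[ z * 1ℤ ]     ≡⟨ cong T[_] (*-identityʳ z) ⟩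
  T[ z ]          ∎

conj-homo : ∀ x g h → x · (g · h) · x ⁻¹ ≡ (x · g · x ⁻¹) · (x · h · x ⁻¹)
conj-homo x g h = begin
  x · (g · h) · x ⁻¹
    ≡⟨ cong (_· x ⁻¹) {x · (g · h)} {x · g · h} (sym (·-assoc x g h)) ⟩
  x · g · h · x ⁻¹
    ≡⟨ cong (_· x ⁻¹) {x · g · h} {x · g · x ⁻¹ · (x · h)} (sym (x·y⁻¹·[y·z]≡x·z (x · g) x h)) ⟩
  x · g · x ⁻¹ · (x · h) · x ⁻¹
    ≡⟨ ·-assoc (x · g · x ⁻¹) (x · h) (x ⁻¹) ⟩
  x · g · x ⁻¹ · (x · h · x ⁻¹)
    ∎

conj-T[]-^ : ∀ x k z → (x · T[ k ] · x ⁻¹) ^ z ≡ x · T[ z * k ] · x ⁻¹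
conj-T[]-^ x = ^-homo (λ k → x · T[ k ] · x ⁻¹) λ k m →
  trans (cong (λ g → x · g · x ⁻¹) {T[ k + m ]} {T[ k ] · T[ m ]} (T[]-homo k m))
        (conj-homo x T[ k ] T[ m ])

module _ {N : ℕ} where

  Γ₁-intro : ∀ g → + N ∣ a g - 1ℤ → + N ∣ c g → + N ∣ d g - 1ℤ → Γ₁ N g
  Γ₁-intro _ N∣a-1 N∣c N∣d-1 = ∣⇒∣ᵤ N∣a-1 , ∣⇒∣ᵤ N∣c , ∣⇒∣ᵤ N∣d-1

  Γ₁-a : ∀ g → Γ₁ N g → + N ∣ a g - 1ℤ
  Γ₁-a _ (N∣a-1 , _ , _) = ∣ᵤ⇒∣ N∣a-1

  Γ₁-c : ∀ g → Γ₁ N g → + N ∣ c g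
  Γ₁-c _ (_ , N∣c , _) = ∣ᵤ⇒∣ N∣c

  Γ₁-d : ∀ g → Γ₁ N g → + N ∣ d g - 1ℤ
  Γ₁-d _ (_ , _ , N∣d-1) = ∣ᵤ⇒∣ N∣d-1

  Γ₁-· : ∀ g h → Γ₁ N g → Γ₁ N h → Γ₁ N (g · h)
  Γ₁-· g@(mkSL2 a₁ b₁ c₁ d₁ _) h@(mkSL2 a₂ b₂ c₂ d₂ _) g∈Γ₁ h∈Γ₁ = Γ₁-intro (g · h)
    (subst (+ N ∣_) (entry-a a₁ b₁ a₂ c₂)
      (∣m∣n⇒∣m+n (∣m∣n⇒∣m+n (∣m⇒∣m*n a₂ (Γ₁-a g g∈Γ₁)) (Γ₁-a h h∈Γ₁)) (∣n⇒∣m*n b₁ (Γ₁-c h h∈Γ₁))))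
    (∣m∣n⇒∣m+n (∣m⇒∣m*n a₂ (Γ₁-c g g∈Γ₁)) (∣n⇒∣m*n d₁ (Γ₁-c h h∈Γ₁)))
    (subst (+ N ∣_) (entry-d c₁ d₁ b₂ d₂)
      (∣m∣n⇒∣m+n (∣m∣n⇒∣m+n (∣m⇒∣m*n b₂ (Γ₁-c g g∈Γ₁)) (∣m⇒∣m*n d₂ (Γ₁-d g g∈Γ₁))) (Γ₁-d h h∈Γ₁)))
    where
    entry-a : ∀ a₁ b₁ a₂ c₂ → (a₁ - 1ℤ) * a₂ + (a₂ - 1ℤ) + b₁ * c₂ ≡ a₁ * a₂ + b₁ * c₂ - 1ℤ
    entry-a = solve-∀
    entry-d : ∀ c₁ d₁ b₂ d₂ → c₁ * b₂ + (d₁ - 1ℤ) * d₂ + (d₂ - 1ℤ) ≡ c₁ * b₂ + d₁ * d₂ - 1ℤ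
    entry-d = solve-∀

  Γ₁-⁻¹ : ∀ g → Γ₁ N g → Γ₁ N (g ⁻¹)
  Γ₁-⁻¹ g@(mkSL2 _ _ _ _ _) g∈Γ₁ =
    Γ₁-intro (g ⁻¹) (Γ₁-d g g∈Γ₁) (∣m⇒∣-m (Γ₁-c g g∈Γ₁)) (Γ₁-a g g∈Γ₁)

  Γ₁-conj-T[] : ∀ x k → + N ∣ k → Γ₁ N (x · T[ k ] · x ⁻¹)
  Γ₁-conj-T[] x@(mkSL2 a b c d det≡1) k N∣k = Γ₁-intro (x · T[ k ] · x ⁻¹)
    (subst (+ N ∣_) (trans (entry-a a b c d k) (cong (λ e → A - e) det≡1)) (∣m⇒∣m*n (- (a * c)) N∣k))
    (subst (+ N ∣_) (entry-c c d k) (∣m⇒∣m*n (- (c * c)) N∣k))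
    (subst (+ N ∣_) (trans (entry-d a b c d k) (cong (λ e → D - e) det≡1)) (∣m⇒∣m*n (a * c) N∣k))
    where
    A D : ℤ
    A = (a * 1ℤ + b * 0ℤ) * d + (a * k + b * 1ℤ) * - c
    D = (c * 1ℤ + d * 0ℤ) * - b + (c * k + d * 1ℤ) * a
    entry-a : ∀ a b c d k →
      k * - (a * c) ≡ (a * 1ℤ + b * 0ℤ) * d + (a * k + b * 1ℤ) * - c - (a * d - b * c)
    entry-a = solve-∀
    entry-c : ∀ c d k → k * - (c * c) ≡ (c * 1ℤ + d * 0ℤ) * d + (c * k + d * 1ℤ) * - c
    entry-c = solve-∀
    entry-d : ∀ a b c d k →
      k * (a * c) ≡ (c * 1ℤ + d * 0ℤ) * - b + (c * k + d * 1ℤ) * a - (a * d - b * c)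
    entry-d = solve-∀

  SameRightCoset-sym : ∀ g h → SameRightCoset N g h → SameRightCoset N h g
  SameRightCoset-sym g h g~h =
    subst (Γ₁ N) {(g · h ⁻¹) ⁻¹} {h · g ⁻¹} (sym h·g⁻¹≡[g·h⁻¹]⁻¹) (Γ₁-⁻¹ (g · h ⁻¹) g~h)
    where
    h·g⁻¹≡[g·h⁻¹]⁻¹ : h · g ⁻¹ ≡ (g · h ⁻¹) ⁻¹
    h·g⁻¹≡[g·h⁻¹]⁻¹ = inverseʳ-unique SL2-group (g · h ⁻¹) (h · g ⁻¹)
      (trans (x·y⁻¹·[y·z]≡x·z g h (g ⁻¹)) (⁻¹-inverseʳ g))

  SameRightCoset-trans : ∀ g h k →
    SameRightCoset N g h → SameRightCoset N h k → SameRightCoset N g k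
  SameRightCoset-trans g h k g~h h~k =
    subst (Γ₁ N) {g · h ⁻¹ · (h · k ⁻¹)} {g · k ⁻¹} (x·y⁻¹·[y·z]≡x·z g h (k ⁻¹))
      (Γ₁-· (g · h ⁻¹) (h · k ⁻¹) g~h h~k)

  Γ₁-·-SameRightCoset : ∀ γ g → Γ₁ N γ → SameRightCoset N (γ · g) g
  Γ₁-·-SameRightCoset γ g = subst (Γ₁ N) {γ} {γ · g · g ⁻¹} (sym (x·y·y⁻¹≡x γ g))

  module _ (τ : RightTransversal N) where
    open RightTransversal τ

    rep-cong : ∀ g h → SameRightCoset N g h → rep g ≡ rep h
    rep-cong g h g~h = unique (rep g) (rep h) (rep-∈ g) (rep-∈ h)
      (SameRightCoset-trans (rep g) g (rep h) (SameRightCoset-sym g (rep g) (rep-coset g))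
        (SameRightCoset-trans g h (rep h) g~h (rep-coset h)))

    rep-fixes-S : ∀ x → S x → rep x ≡ x
    rep-fixes-S x x∈S = unique (rep x) x (rep-∈ x) x∈S (SameRightCoset-sym x (rep x) (rep-coset x))

    -- Opaque for the same reason: unfolded, g · rep g ⁻¹ would be normalised
    -- whenever it occurs under _·_.
    opaque
      Γ₁-part : SL2 → SL2
      Γ₁-part g = g · rep g ⁻¹

      Γ₁-part-unfold : ∀ g → Γ₁-part g ≡ g · rep g ⁻¹
      Γ₁-part-unfold g = refl

      U≡Γ₁-part : ∀ x y → U τ x y ≡ Γ₁-part (x · y)
      U≡Γ₁-part x y = refl

    Γ₁-part-Γ₁ : ∀ γ g → Γ₁ N γ → Γ₁-part (γ · g) ≡ γ · Γ₁-part g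
    Γ₁-part-Γ₁ γ g γ∈Γ₁ = begin
      Γ₁-part (γ · g)
        ≡⟨ Γ₁-part-unfold (γ · g) ⟩
      γ · g · rep (γ · g) ⁻¹
        ≡⟨ cong (λ h → γ · g · h ⁻¹) {rep (γ · g)} {rep g}
                (rep-cong (γ · g) g (Γ₁-·-SameRightCoset γ g γ∈Γ₁)) ⟩
      γ · g · rep g ⁻¹
        ≡⟨ ·-assoc γ g (rep g ⁻¹) ⟩
      γ · (g · rep g ⁻¹)
        ≡⟨ cong (γ ·_) {g · rep g ⁻¹} {Γ₁-part g} (sym (Γ₁-part-unfold g)) ⟩
      γ · Γ₁-part g
        ∎

    Γ₁-part-S : ∀ x → S x → Γ₁-part x ≡ I
    Γ₁-part-S x x∈S = begin
      Γ₁-part x      ≡⟨ Γ₁-part-unfold x ⟩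
      x · rep x ⁻¹   ≡⟨ cong (λ h → x · h ⁻¹) {rep x} {x} (rep-fixes-S x x∈S) ⟩
      x · x ⁻¹       ≡⟨ ⁻¹-inverseʳ x ⟩
      I              ∎

    Γ₁-part-shift : ∀ x k m → + N ∣ k →
      Γ₁-part (x · T[ k + m ]) ≡ x · T[ k ] · x ⁻¹ · Γ₁-part (x · T[ m ])
    Γ₁-part-shift x k m N∣k = begin
      Γ₁-part (x · T[ k + m ])
        ≡⟨ cong Γ₁-part {x · T[ k + m ]} {x · T[ k ] · x ⁻¹ · (x · T[ m ])} shift ⟩
      Γ₁-part (x · T[ k ] · x ⁻¹ · (x · T[ m ]))
        ≡⟨ Γ₁-part-Γ₁ (x · T[ k ] · x ⁻¹) (x · T[ m ]) (Γ₁-conj-T[] x k N∣k) ⟩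
      x · T[ k ] · x ⁻¹ · Γ₁-part (x · T[ m ])
        ∎
      where
      shift : x · T[ k + m ] ≡ x · T[ k ] · x ⁻¹ · (x · T[ m ])
      shift = begin
        x · T[ k + m ]
          ≡⟨ cong (x ·_) {T[ k + m ]} {T[ k ] · T[ m ]} (T[]-homo k m) ⟩
        x · (T[ k ] · T[ m ])
          ≡⟨ sym (·-assoc x T[ k ] T[ m ]) ⟩
        x · T[ k ] · T[ m ]
          ≡⟨ sym (x·y⁻¹·[y·z]≡x·z (x · T[ k ]) x T[ m ]) ⟩
        x · T[ k ] · x ⁻¹ · (x · T[ m ])
          ∎

    Γ₁-part-period : ∀ x → S x → Γ₁-part (x · T ^ (+ N)) ≡ x · T[ + N ] · x ⁻¹
    Γ₁-part-period x x∈S = begin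
      Γ₁-part (x · T ^ (+ N))
        ≡⟨ cong (λ t → Γ₁-part (x · t)) {T ^ (+ N)} {T[ + N ]} (T^≡T[] (+ N)) ⟩
      Γ₁-part (x · T[ + N ])
        ≡⟨ cong Γ₁-part {x · T[ + N ]} {x · T[ + N ] · x ⁻¹ · x} (sym (x·y⁻¹·y≡x (x · T[ + N ]) x)) ⟩
      Γ₁-part (x · T[ + N ] · x ⁻¹ · x)
        ≡⟨ Γ₁-part-Γ₁ (x · T[ + N ] · x ⁻¹) x (Γ₁-conj-T[] x (+ N) ∣-refl) ⟩
      x · T[ + N ] · x ⁻¹ · Γ₁-part x
        ≡⟨ cong (x · T[ + N ] · x ⁻¹ ·_) {Γ₁-part x} {I} (Γ₁-part-S x x∈S) ⟩
      x · T[ + N ] · x ⁻¹ · I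
        ≡⟨ ·-identityʳ (x · T[ + N ] · x ⁻¹) ⟩
      x · T[ + N ] · x ⁻¹
        ∎

    U-T^-decomposition : ∀ x → S x → ∀ a q r → a ≡ q * + N + r →
      U τ x (T ^ a) ≡ U τ x (T ^ (+ N)) ^ q · U τ x (T ^ r)
    U-T^-decomposition x x∈S a q r a≡qN+r =
      trans {k = U τ x (T ^ (+ N)) ^ q · U τ x (T ^ r)} decomposition
        (cong₂ (λ g h → g ^ q · h) {x · T[ + N ] · x ⁻¹} {U τ x (T ^ (+ N))}
                                   {Γ₁-part (x · T ^ r)} {U τ x (T ^ r)}
          (sym (trans (U≡Γ₁-part x (T ^ (+ N))) (Γ₁-part-period x x∈S)))
          (sym (U≡Γ₁-part x (T ^ r))))
      where
      decomposition : U τ x (T ^ a) ≡ (x · T[ + N ] · x ⁻¹) ^ q · Γ₁-part (x · T ^ r)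
      decomposition = begin
        U τ x (T ^ a)
          ≡⟨ U≡Γ₁-part x (T ^ a) ⟩
        Γ₁-part (x · T ^ a)
          ≡⟨ cong (λ t → Γ₁-part (x · t)) {T ^ a} {T[ q * + N + r ]}
                  (trans (T^≡T[] a) (cong T[_] a≡qN+r)) ⟩
        Γ₁-part (x · T[ q * + N + r ])
          ≡⟨ Γ₁-part-shift x (q * + N) r (∣n⇒∣m*n q ∣-refl) ⟩
        x · T[ q * + N ] · x ⁻¹ · Γ₁-part (x · T[ r ])
          ≡⟨ cong₂ _·_ {x · T[ q * + N ] · x ⁻¹} {(x · T[ + N ] · x ⁻¹) ^ q}
                       {Γ₁-part (x · T[ r ])} {Γ₁-part (x · T ^ r)}
                   (sym (conj-T[]-^ x (+ N) q))
                   (cong (λ t → Γ₁-part (x · t)) {T[ r ]} {T ^ r} (sym (T^≡T[] r))) ⟩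
        (x · T[ + N ] · x ⁻¹) ^ q · Γ₁-part (x · T ^ r)
          ∎

lemma2p18 : (N : ℕ) → N ≥ 1 → (τ : RightTransversal N) →
    (a q r : ℤ) → a ≡ q * (+ N) + r → 0ℤ ≤ r → r < (+ N) →
    (M : SL2) →
    let Mb = RightTransversal.rep τ M in
    U τ Mb (T ^ a) ≡ (U τ Mb (T ^ (+ N)) ^ q) · U τ Mb (T ^ r)
lemma2p18 N _ τ a q r a≡qN+r _ _ M =
  U-T^-decomposition τ (RightTransversal.rep τ M) (RightTransversal.rep-∈ τ M) a q r a≡qN+r
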